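{- Assume the standing assumptions in the context. Let $q$ be a power of a good prime. Then for every $n\in\mathbb{Z}$, $$\mathfrak{S}_q(n)=\frac{1}{|\Gamma(q)\backslash\Gamma|}\sum_{\gamma\in\Gamma(q)\backslash\Gamma}c_q(a_\gamma+\Delta d_\gamma-n),$$ where $a_\gamma,d_\gamma$ denote the diagonal entries of $\gamma$.
   Context: $\Gamma<\mathrm{SL}_2(\mathbb{Z})$ is Zariski dense in $\mathrm{SL}_2$. $A,B,C,D$ are integers with $\gcd(A,B,C,D)=1$; for $\gamma=\begin{pmatrix}a&b\\c&d\end{pmatrix}$ put $\mathscr{L}(\gamma)=Aa+Bb+Cc+Dd$, and $\Delta=AD-BC$. For $q\ge1$, $\Gamma(q)=\{\gamma\in\Gamma:\gamma\equiv I\pmod q\}$. A prime $p$ is called good if $p$ is odd and for every $\ell\ge1$ the reduction map $\Gamma\to\mathrm{SL}_2(\mathbb{Z}/p^\ell\mathbb{Z})$ is surjective. $c_q(x)=\sum_{r \bmod q,\ (r,q)=1}e^{2\pi i rx/q}$ is the Ramanujan sum. For $n\in\mathbb{Z}$, $\mathfrak{S}_q(n)=\frac1{[\Gamma:\Gamma(q)]}\sum_{\gamma\in\Gamma(q)\backslash\Gamma}c_q(\mathscr{L}(\gamma)-n)$ (well defined since $\mathscr{L}(\gamma)\bmod q$ depends only on the coset). -}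

module Defs where

open import Data.Nat as ℕ using (ℕ; zero; suc; _≤?_)
open import Data.Nat.Divisibility as ℕD using (_∣?_)
open import Data.Nat.Primality using (Prime; prime?)
open import Data.Nat.GCD using (gcd)
open import Data.Integer as ℤ using (ℤ; +_; -_; _+_; _-_; _*_; ∣_∣; 0ℤ; 1ℤ; -1ℤ)
open import Data.Integer.Divisibility using (_∣_)
open import Data.List using (List; []; _∷_; foldr; map; filter; length; upTo)
open import Data.List.Relation.Unary.All using (All)
open import Data.List.Relation.Unary.Any using (Any)
open import Data.List.Relation.Unary.AllPairs using (AllPairs)
open import Data.Fin using (Fin)
open import Data.Product using (Σ; _×_; ∃)
open import Relation.Nullary using (¬_; yes; no)
open import Relation.Nullary.Decidable using (_×-dec_)
open import Relation.Binary.PropositionalEquality using (_≡_)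

record M2 : Set where
  constructor mat
  field
    a b c d : ℤ
open M2 public

det : M2 → ℤ
det (mat a b c d) = a * d - b * c

I₂ : M2
I₂ = mat 1ℤ 0ℤ 0ℤ 1ℤ

_·_ : M2 → M2 → M2
mat a b c d · mat a' b' c' d' =
  mat (a * a' + b * c') (a * b' + b * d') (c * a' + d * c') (c * b' + d * d')

-- inverse of a determinant-one matrix
inv : M2 → M2
inv (mat a b c d) = mat d (- b) (- c) a

_≡_[mod_] : ℤ → ℤ → ℕ → Set
x ≡ y [mod m ] = (+ m) ∣ (x - y)

_≡ᴹ_[mod_] : M2 → M2 → ℕ → Set
M ≡ᴹ N [mod m ] =
  (a M ≡ a N [mod m ]) × (b M ≡ b N [mod m ]) ×
  (c M ≡ c N [mod m ]) × (d M ≡ d N [mod m ])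

record IsSubgroupSL2 (Γ : M2 → Set) : Set where
  field
    inSL2   : ∀ γ → Γ γ → det γ ≡ 1ℤ
    hasI    : Γ I₂
    mulClos : ∀ γ δ → Γ γ → Γ δ → Γ (γ · δ)
    invClos : ∀ γ → Γ γ → Γ (inv γ)

data Poly : Set where
  var   : Fin 4 → Poly
  const : ℤ → Poly
  _⊕_   : Poly → Poly → Poly
  _⊗_   : Poly → Poly → Poly

evalP : Poly → M2 → ℤ
evalP (var Fin.zero) M = a M
evalP (var (Fin.suc Fin.zero)) M = b M
evalP (var (Fin.suc (Fin.suc Fin.zero))) M = c M
evalP (var (Fin.suc (Fin.suc (Fin.suc Fin.zero)))) M = d M
evalP (const k) M = k
evalP (P ⊕ Q) M = evalP P M + evalP Q M
evalP (P ⊗ Q) M = evalP P M * evalP Q M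

-- Zariski density in SL2: every polynomial (with rational, equivalently
-- integer, coefficients) vanishing on Γ vanishes on SL2(Z), which is
-- Zariski dense in SL2.
ZariskiDense : (M2 → Set) → Set
ZariskiDense Γ = ∀ (P : Poly) → (∀ γ → Γ γ → evalP P γ ≡ 0ℤ) →
                 ∀ M → det M ≡ 1ℤ → evalP P M ≡ 0ℤ

Γ[_] : (M2 → Set) → ℕ → M2 → Set
Γ[ Γ ] q γ = Γ γ × (γ ≡ᴹ I₂ [mod q ])

SameCoset : (M2 → Set) → ℕ → M2 → M2 → Set
SameCoset Γ q γ ρ = Σ M2 (λ δ → Γ[ Γ ] q δ × (γ ≡ δ · ρ))

IsCosetReps : (M2 → Set) → ℕ → List M2 → Set
IsCosetReps Γ q reps =
  All Γ reps ×
  (∀ γ → Γ γ → Any (SameCoset Γ q γ) reps) ×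
  AllPairs (λ ρ σ → ¬ SameCoset Γ q ρ σ) reps

ReductionSurjective : (M2 → Set) → ℕ → Set
ReductionSurjective Γ m =
  ∀ (M : M2) → det M ≡ 1ℤ [mod m ] → ∃ (λ γ → Γ γ × (γ ≡ᴹ M [mod m ]))

Good : (M2 → Set) → ℕ → Set
Good Γ p = Prime p × ¬ (2 ℕD.∣ p) ×
           (∀ ℓ → 1 ℕ.≤ ℓ → ReductionSurjective Γ (p ℕ.^ ℓ))

sumℤ : List ℤ → ℤ
sumℤ = foldr _+_ 0ℤ

ω : ℕ → ℕ
ω n = length (filter (λ p → prime? p ×-dec (p ∣? n)) (upTo (suc n)))

-- Möbius function (on n ≥ 1)
μ : ℕ → ℤ
μ n with filter (λ k → (2 ≤? k) ×-dec ((k ℕ.* k) ∣? n)) (upTo (suc n))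
... | []    = -1ℤ ℤ.^ ω n
... | _ ∷ _ = 0ℤ

-- Ramanujan sum c_q(x) via Kluyver's formula
-- c_q(x) = Σ_{d ∣ q, d ∣ x} μ(q/d) d  (= Σ_{r mod q,(r,q)=1} e(rx/q))
ramanujan : ℕ → ℤ → ℤ
ramanujan q x = sumℤ (map term (upTo q))
  where
  term : ℕ → ℤ
  term k with suc k ∣? q | suc k ∣? ∣ x ∣
  ... | yes _ | yes _ = μ (q ℕ./ suc k) * + suc k
  ... | _     | _     = 0ℤ

𝓛 : ℤ → ℤ → ℤ → ℤ → M2 → ℤ
𝓛 A B C D γ = A * a γ + B * b γ + C * c γ + D * d γ

gcd4 : ℤ → ℤ → ℤ → ℤ → ℕ
gcd4 A B C D = gcd (gcd ∣ A ∣ ∣ B ∣) (gcd ∣ C ∣ ∣ D ∣)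

{-# OPTIONS --safe #-}
-- Write 𝓛(γ) = tr(Nγ) with N = (A C; B D), and a + Δd = tr(diag(1, Δ)γ) with Δ = det N.
-- Since gcd(A, B, C, D) = 1, some entry of N is a unit modulo q = p^ℓ, and row and column
-- operations bring N to its Smith form: N ≡ P·diag(1, Δ)·Q (mod q) with det P ≡ det Q ≡ 1.
-- Cyclicity of the trace gives tr(Nγ) ≡ tr(diag(1, Δ)·QγP). As Γ surjects onto SL₂(ℤ/q),
-- the cosets Γ(q)\Γ are the points of SL₂(ℤ/q), which γ ↦ QγP permutes, and c_q(x) only
-- depends on x mod q; so reindexing the sum turns one side into the other.
module Submission where

open import Defs
open import Data.Fin as Fin using (Fin)
import Data.Fin.Properties as Fin
open import Data.Fin.Permutation using (Permutation′; permutation; _⟨$⟩ʳ_)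
open import Data.Integer as ℤ using (ℤ; +_; -[1+_]; -_; _+_; _-_; _*_; ∣_∣; 0ℤ; 1ℤ; -1ℤ)
import Data.Integer.Divisibility.Signed as ∣ₛ
open ∣ₛ using () renaming (_∣_ to _∣ₛ_)
import Data.Integer.Properties as ℤ
open import Algebra.Properties.CommutativeMonoid.Sum ℤ.+-0-commutativeMonoid
  using (sum; sum-cong-≗; ∑-permute)
open import Data.Integer.Tactic.RingSolver using (solve)
open import Data.List using (List; []; _∷_; map; upTo; length; lookup)
open import Data.List.Membership.Propositional.Properties using (∈-lookup)
open import Data.List.Properties using (map-cong)
import Data.List.Relation.Unary.All as All
open import Data.List.Relation.Unary.AllPairs using (AllPairs; _∷_)
open import Data.List.Relation.Unary.Any as Any using (Any)
open import Data.List.Relation.Unary.Any.Properties using (lookup-index)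
open import Data.Nat as ℕ using (ℕ; zero; suc; _≤_; _^_; s≤s)
open import Data.Nat.Coprimality using (Coprime; coprime-Bézout; coprime-divisor)
open import Data.Nat.Divisibility using (∣1⇒≡1; ∣-trans) renaming (_∣_ to _ℕ∣_; _∣?_ to _ℕ∣?_)
open import Data.Nat.GCD using (module Bézout; gcd-greatest)
open import Data.Nat.Primality using (Prime; prime⇒irreducible; ¬prime[1])
open import Data.Product using (Σ; Σ-syntax; _,_; proj₁; proj₂)
open import Data.Sum using (_⊎_; inj₁; inj₂)
open import Function using (_∘_)
open import Level using (0ℓ)
open import Relation.Binary.Bundles using (Setoid)
open import Relation.Binary.Definitions using (tri<; tri≈; tri>)
open import Relation.Binary.PropositionalEquality
  using (_≡_; refl; sym; trans; cong; subst; module ≡-Reasoning)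
import Relation.Binary.Reasoning.Setoid as ≈-Reasoning
open import Relation.Nullary using (¬_; yes; no; contradiction)

mat-cong : ∀ {a₁ b₁ c₁ d₁ a₂ b₂ c₂ d₂} →
           a₁ ≡ a₂ → b₁ ≡ b₂ → c₁ ≡ c₂ → d₁ ≡ d₂ → mat a₁ b₁ c₁ d₁ ≡ mat a₂ b₂ c₂ d₂
mat-cong refl refl refl refl = refl

diag : ℤ → ℤ → M2
diag s t = mat s 0ℤ 0ℤ t

tr : M2 → ℤ
tr X = a X + d X

-- The ring solver reads goals only up to weak head normal form, so identities between
-- matrix entries are stated on the unfolded entries.
·-assoc : (X Y Z : M2) → (X · Y) · Z ≡ X · (Y · Z)
·-assoc (mat a₁ b₁ c₁ d₁) (mat a₂ b₂ c₂ d₂) (mat a₃ b₃ c₃ d₃) =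
  mat-cong (entry a₁ b₁ a₃ c₃) (entry a₁ b₁ b₃ d₃) (entry c₁ d₁ a₃ c₃) (entry c₁ d₁ b₃ d₃)
  where
  entry : ∀ x y u v → (x * a₂ + y * c₂) * u + (x * b₂ + y * d₂) * v
                    ≡ x * (a₂ * u + b₂ * v) + y * (c₂ * u + d₂ * v)
  entry x y u v = solve (x ∷ y ∷ u ∷ v ∷ a₂ ∷ b₂ ∷ c₂ ∷ d₂ ∷ [])

·-identityˡ : (X : M2) → I₂ · X ≡ X
·-identityˡ (mat x y z w) = mat-cong (top x z) (top y w) (bottom x z) (bottom y w)
  where
  top : ∀ s t → 1ℤ * s + 0ℤ * t ≡ s
  top s t = solve (s ∷ t ∷ [])
  bottom : ∀ s t → 0ℤ * s + 1ℤ * t ≡ t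
  bottom s t = solve (s ∷ t ∷ [])

·-identityʳ : (X : M2) → X · I₂ ≡ X
·-identityʳ (mat x y z w) = mat-cong (left x y) (right x y) (left z w) (right z w)
  where
  left : ∀ s t → s * 1ℤ + t * 0ℤ ≡ s
  left s t = solve (s ∷ t ∷ [])
  right : ∀ s t → s * 0ℤ + t * 1ℤ ≡ t
  right s t = solve (s ∷ t ∷ [])

inv-inverseˡ : (X : M2) → inv X · X ≡ diag (det X) (det X)
inv-inverseˡ (mat x y z w) = mat-cong diagonal off-diagonal off-diagonal′ diagonal′
  where
  diagonal : w * x + (- y) * z ≡ x * w - y * z
  diagonal = solve (x ∷ y ∷ z ∷ w ∷ [])
  off-diagonal : w * y + (- y) * w ≡ 0ℤ
  off-diagonal = solve (y ∷ w ∷ [])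
  off-diagonal′ : (- z) * x + x * z ≡ 0ℤ
  off-diagonal′ = solve (x ∷ z ∷ [])
  diagonal′ : (- z) * y + x * w ≡ x * w - y * z
  diagonal′ = solve (x ∷ y ∷ z ∷ w ∷ [])

inv-inverseʳ : (X : M2) → X · inv X ≡ diag (det X) (det X)
inv-inverseʳ (mat x y z w) = mat-cong diagonal off-diagonal off-diagonal′ diagonal′
  where
  diagonal : x * w + y * (- z) ≡ x * w - y * z
  diagonal = solve (x ∷ y ∷ z ∷ w ∷ [])
  off-diagonal : x * (- y) + y * x ≡ 0ℤ
  off-diagonal = solve (x ∷ y ∷ [])
  off-diagonal′ : z * w + w * (- z) ≡ 0ℤ
  off-diagonal′ = solve (z ∷ w ∷ [])
  diagonal′ : z * (- y) + w * x ≡ x * w - y * z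
  diagonal′ = solve (x ∷ y ∷ z ∷ w ∷ [])

inv-inverseˡ-SL2 : ∀ X → det X ≡ 1ℤ → inv X · X ≡ I₂
inv-inverseˡ-SL2 X det-X = trans (inv-inverseˡ X) (cong (λ s → diag s s) det-X)

inv-inverseʳ-SL2 : ∀ X → det X ≡ 1ℤ → X · inv X ≡ I₂
inv-inverseʳ-SL2 X det-X = trans (inv-inverseʳ X) (cong (λ s → diag s s) det-X)

det-· : (X Y : M2) → det (X · Y) ≡ det X * det Y
det-· (mat x₁ y₁ z₁ w₁) (mat x₂ y₂ z₂ w₂) = expand
  where
  expand : (x₁ * x₂ + y₁ * z₂) * (z₁ * y₂ + w₁ * w₂) - (x₁ * y₂ + y₁ * w₂) * (z₁ * x₂ + w₁ * z₂)
         ≡ (x₁ * w₁ - y₁ * z₁) * (x₂ * w₂ - y₂ * z₂)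
  expand = solve (x₁ ∷ y₁ ∷ z₁ ∷ w₁ ∷ x₂ ∷ y₂ ∷ z₂ ∷ w₂ ∷ [])

det-·-SL2ʳ : ∀ X J → det J ≡ 1ℤ → det (X · J) ≡ det X
det-·-SL2ʳ X J det-J = trans (det-· X J) (trans (cong (det X *_) det-J) (ℤ.*-identityʳ (det X)))

det-·-SL2ˡ : ∀ J X → det J ≡ 1ℤ → det (J · X) ≡ det X
det-·-SL2ˡ J X det-J = trans (det-· J X) (trans (cong (_* det X) det-J) (ℤ.*-identityˡ (det X)))

det-inv : (X : M2) → det (inv X) ≡ det X
det-inv (mat x y z w) = expand
  where
  expand : w * x - (- y) * (- z) ≡ x * w - y * z
  expand = solve (x ∷ y ∷ z ∷ w ∷ [])

tr-comm : (X Y : M2) → tr (X · Y) ≡ tr (Y · X)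
tr-comm (mat x₁ y₁ z₁ w₁) (mat x₂ y₂ z₂ w₂) = expand
  where
  expand : (x₁ * x₂ + y₁ * z₂) + (z₁ * y₂ + w₁ * w₂) ≡ (x₂ * x₁ + y₂ * z₁) + (z₂ * y₁ + w₂ * w₁)
  expand = solve (x₁ ∷ y₁ ∷ z₁ ∷ w₁ ∷ x₂ ∷ y₂ ∷ z₂ ∷ w₂ ∷ [])

tr-sandwich : (P M Q X : M2) → tr (((P · M) · Q) · X) ≡ tr (M · ((Q · X) · P))
tr-sandwich P M Q X = begin
  tr (((P · M) · Q) · X)   ≡⟨ cong tr (·-assoc (P · M) Q X) ⟩
  tr ((P · M) · (Q · X))   ≡⟨ cong tr (·-assoc P M (Q · X)) ⟩
  tr (P · (M · (Q · X)))   ≡⟨ tr-comm P (M · (Q · X)) ⟩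
  tr ((M · (Q · X)) · P)   ≡⟨ cong tr (·-assoc M (Q · X) P) ⟩
  tr (M · ((Q · X) · P))   ∎
  where open ≡-Reasoning

𝓛-as-trace : ∀ A B C D X → 𝓛 A B C D X ≡ tr (mat A C B D · X)
𝓛-as-trace A B C D (mat x y z w) = regroup
  where
  regroup : A * x + B * y + C * z + D * w ≡ (A * x + C * z) + (B * y + D * w)
  regroup = solve (A ∷ B ∷ C ∷ D ∷ x ∷ y ∷ z ∷ w ∷ [])

diagonal-form-as-trace : ∀ t X → a X + t * d X ≡ tr (diag 1ℤ t · X)
diagonal-form-as-trace t (mat x y z w) = expand
  where
  expand : x + t * w ≡ (1ℤ * x + 0ℤ * z) + (0ℤ * y + t * w)
  expand = solve (t ∷ x ∷ y ∷ z ∷ w ∷ [])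

S : M2
S = mat 0ℤ -1ℤ 1ℤ 0ℤ

a-·S : ∀ X → a (X · S) ≡ b X
a-·S (mat x y z w) = expand
  where
  expand : x * 0ℤ + y * 1ℤ ≡ y
  expand = solve (x ∷ y ∷ [])

a-S⁻¹· : ∀ X → a (inv S · X) ≡ c X
a-S⁻¹· (mat x y z w) = expand
  where
  expand : 0ℤ * x + 1ℤ * z ≡ z
  expand = solve (x ∷ z ∷ [])

b-S⁻¹· : ∀ X → b (inv S · X) ≡ d X
b-S⁻¹· (mat x y z w) = expand
  where
  expand : 0ℤ * y + 1ℤ * w ≡ w
  expand = solve (y ∷ w ∷ [])

sumℤ-map-lookup : ∀ {A : Set} (h : A → ℤ) (xs : List A) → sumℤ (map h xs) ≡ sum (h ∘ lookup xs)
sumℤ-map-lookup h []       = refl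
sumℤ-map-lookup h (x ∷ xs) = cong (λ s → h x + s) (sumℤ-map-lookup h xs)

sumℤ-map-cong : ∀ {A : Set} {g h : A → ℤ} → (∀ x → g x ≡ h x) → ∀ xs →
                sumℤ (map g xs) ≡ sumℤ (map h xs)
sumℤ-map-cong g≗h xs = cong sumℤ (map-cong g≗h xs)

AllPairs-lookup : ∀ {A : Set} {R : A → A → Set} {xs : List A} → AllPairs R xs →
                  ∀ {i j} → i Fin.< j → R (lookup xs i) (lookup xs j)
AllPairs-lookup (Rx ∷ _)     {Fin.zero}  {Fin.suc j} _         = All.lookup Rx (∈-lookup j)
AllPairs-lookup (_  ∷ pairs) {Fin.suc i} {Fin.suc j} (s≤s i<j) = AllPairs-lookup pairs i<j

pos-1+* : ∀ s t s′ t′ → 1 ℕ.+ s ℕ.* t ≡ s′ ℕ.* t′ → 1ℤ + + s * + t ≡ + s′ * + t′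
pos-1+* s t s′ t′ eq = begin
  1ℤ + + s * + t     ≡⟨ cong (λ k → 1ℤ + k) (ℤ.pos-* s t) ⟨
  + (1 ℕ.+ s ℕ.* t)  ≡⟨ cong +_ eq ⟩
  + (s′ ℕ.* t′)      ≡⟨ ℤ.pos-* s′ t′ ⟩
  + s′ * + t′        ∎
  where open ≡-Reasoning

prime∤⇒coprime : ∀ {p m} → Prime p → ¬ p ℕ∣ m → Coprime m p
prime∤⇒coprime p-prime p∤m (k∣m , k∣p) with prime⇒irreducible p-prime k∣p
... | inj₁ k≡1 = k≡1
... | inj₂ refl = contradiction k∣m p∤m

coprime-^ʳ : ∀ {m n} → Coprime m n → ∀ k → Coprime m (n ^ k)
coprime-^ʳ m⊥n zero    (_ , i∣1)               = ∣1⇒≡1 i∣1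
coprime-^ʳ {n = n} m⊥n (suc k) {i} (i∣m , i∣n*nᵏ) =
  coprime-^ʳ m⊥n k (i∣m , coprime-divisor i⊥n i∣n*nᵏ)
  where
  i⊥n : Coprime i n
  i⊥n (j∣i , j∣n) = m⊥n (∣-trans j∣i i∣m , j∣n)

module Modulo (q : ℕ) where

  infix 4 _≈_ _≈ᴹ_

  -- Unlike Defs' _≡_[mod_], a record lets Agda infer x and y from a proof of x ≈ y.
  record _≈_ (x y : ℤ) : Set where
    constructor ≈-intro
    field
      modulus∣difference : + q ∣ₛ x - y

  ≈-refl : ∀ {x} → x ≈ x
  ≈-refl {x} = ≈-intro (∣ₛ.divides 0ℤ (ℤ.+-inverseʳ x))

  ≈-reflexive : ∀ {x y} → x ≡ y → x ≈ y
  ≈-reflexive refl = ≈-refl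

  ≈-sym : ∀ {x y} → x ≈ y → y ≈ x
  ≈-sym {x} {y} (≈-intro q∣x-y) = ≈-intro (subst (+ q ∣ₛ_) negate (∣ₛ.∣m⇒∣-m q∣x-y))
    where
    negate : - (x - y) ≡ y - x
    negate = solve (x ∷ y ∷ [])

  ≈-trans : ∀ {x y z} → x ≈ y → y ≈ z → x ≈ z
  ≈-trans {x} {y} {z} (≈-intro q∣x-y) (≈-intro q∣y-z) =
    ≈-intro (subst (+ q ∣ₛ_) telescope (∣ₛ.∣m∣n⇒∣m+n q∣x-y q∣y-z))
    where
    telescope : (x - y) + (y - z) ≡ x - z
    telescope = solve (x ∷ y ∷ z ∷ [])

  ≈-setoid : Setoid 0ℓ 0ℓ
  ≈-setoid = record
    { Carrier       = ℤ
    ; _≈_           = _≈_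
    ; isEquivalence = record { refl = ≈-refl ; sym = ≈-sym ; trans = ≈-trans }
    }

  +-cong : ∀ {x y u v} → x ≈ y → u ≈ v → x + u ≈ y + v
  +-cong {x} {y} {u} {v} (≈-intro q∣x-y) (≈-intro q∣u-v) =
    ≈-intro (subst (+ q ∣ₛ_) regroup (∣ₛ.∣m∣n⇒∣m+n q∣x-y q∣u-v))
    where
    regroup : (x - y) + (u - v) ≡ (x + u) - (y + v)
    regroup = solve (x ∷ y ∷ u ∷ v ∷ [])

  *-cong : ∀ {x y u v} → x ≈ y → u ≈ v → x * u ≈ y * v
  *-cong {x} {y} {u} {v} (≈-intro q∣x-y) (≈-intro q∣u-v) =
    ≈-intro (subst (+ q ∣ₛ_) regroup (∣ₛ.∣m∣n⇒∣m+n (∣ₛ.∣m⇒∣m*n u q∣x-y) (∣ₛ.∣n⇒∣m*n y q∣u-v)))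
    where
    regroup : (x - y) * u + y * (u - v) ≡ x * u - y * v
    regroup = solve (x ∷ y ∷ u ∷ v ∷ [])

  +-multiple≈ : ∀ x k → x + k * + q ≈ x
  +-multiple≈ x k = ≈-intro (∣ₛ.divides k (cancel (+ q)))
    where
    cancel : ∀ m → x + k * m - x ≡ k * m
    cancel m = solve (x ∷ k ∷ m ∷ [])

  ≡-mod⇒≈ : ∀ {x y} → x ≡ y [mod q ] → x ≈ y
  ≡-mod⇒≈ q∣x-y = ≈-intro (∣ₛ.∣ᵤ⇒∣ q∣x-y)

  ≈⇒≡-mod : ∀ {x y} → x ≈ y → x ≡ y [mod q ]
  ≈⇒≡-mod (≈-intro q∣x-y) = ∣ₛ.∣⇒∣ᵤ q∣x-y

  -- ramanujan sums a where-bound function of Defs, which cannot be named; unification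
  -- recovers it.
  private
    summand : ∀ x → Σ (ℕ → ℤ) λ f → ramanujan q x ≡ sumℤ (map f (upTo q))
    summand x = _ , refl

  ∣-resp-≈ : ∀ {k x y} → k ℕ∣ q → x ≈ y → k ℕ∣ ∣ x ∣ → k ℕ∣ ∣ y ∣
  ∣-resp-≈ {k} {x} {y} k∣q (≈-intro q∣x-y) k∣x =
    ∣ₛ.∣⇒∣ᵤ (subst (+ k ∣ₛ_) cancel
      (∣ₛ.∣m∣n⇒∣m-n (∣ₛ.∣ᵤ⇒∣ {i = x} k∣x) (∣ₛ.∣-trans (∣ₛ.∣ᵤ⇒∣ k∣q) q∣x-y)))
    where
    cancel : x - (x - y) ≡ y
    cancel = solve (x ∷ y ∷ [])

  ramanujan-cong : ∀ {x y} → x ≈ y → ramanujan q x ≡ ramanujan q y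
  ramanujan-cong {x} {y} x≈y = sumℤ-map-cong summand-cong (upTo q)
    where
    summand-cong : ∀ k → proj₁ (summand x) k ≡ proj₁ (summand y) k
    summand-cong k with suc k ℕ∣? q | suc k ℕ∣? ∣ x ∣ | suc k ℕ∣? ∣ y ∣
    ... | yes _   | yes _   | yes _   = refl
    ... | yes k∣q | yes k∣x | no  k∤y = contradiction (∣-resp-≈ k∣q x≈y k∣x) k∤y
    ... | yes k∣q | no  k∤x | yes k∣y = contradiction (∣-resp-≈ k∣q (≈-sym x≈y) k∣y) k∤x
    ... | yes _   | no  _   | no  _   = refl
    ... | no  _   | _       | _       = refl

  record _≈ᴹ_ (X Y : M2) : Set where
    constructor entrywise
    field
      a≈ : a X ≈ a Y
      b≈ : b X ≈ b Y
      c≈ : c X ≈ c Y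
      d≈ : d X ≈ d Y

  ≈ᴹ-refl : ∀ {X} → X ≈ᴹ X
  ≈ᴹ-refl = entrywise ≈-refl ≈-refl ≈-refl ≈-refl

  ≈ᴹ-reflexive : ∀ {X Y} → X ≡ Y → X ≈ᴹ Y
  ≈ᴹ-reflexive refl = ≈ᴹ-refl

  ≈ᴹ-sym : ∀ {X Y} → X ≈ᴹ Y → Y ≈ᴹ X
  ≈ᴹ-sym (entrywise a≈ b≈ c≈ d≈) = entrywise (≈-sym a≈) (≈-sym b≈) (≈-sym c≈) (≈-sym d≈)

  ≈ᴹ-trans : ∀ {X Y Z} → X ≈ᴹ Y → Y ≈ᴹ Z → X ≈ᴹ Z
  ≈ᴹ-trans (entrywise a≈ b≈ c≈ d≈) (entrywise a≈′ b≈′ c≈′ d≈′) =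
    entrywise (≈-trans a≈ a≈′) (≈-trans b≈ b≈′) (≈-trans c≈ c≈′) (≈-trans d≈ d≈′)

  ≈ᴹ-setoid : Setoid 0ℓ 0ℓ
  ≈ᴹ-setoid = record
    { Carrier       = M2
    ; _≈_           = _≈ᴹ_
    ; isEquivalence = record { refl = ≈ᴹ-refl ; sym = ≈ᴹ-sym ; trans = ≈ᴹ-trans }
    }

  ·-cong : ∀ {X X′ Y Y′} → X ≈ᴹ X′ → Y ≈ᴹ Y′ → X · Y ≈ᴹ X′ · Y′
  ·-cong (entrywise a≈ b≈ c≈ d≈) (entrywise a≈′ b≈′ c≈′ d≈′) =
    entrywise (+-cong (*-cong a≈ a≈′) (*-cong b≈ c≈′)) (+-cong (*-cong a≈ b≈′) (*-cong b≈ d≈′))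
              (+-cong (*-cong c≈ a≈′) (*-cong d≈ c≈′)) (+-cong (*-cong c≈ b≈′) (*-cong d≈ d≈′))

  tr-cong : ∀ {X Y} → X ≈ᴹ Y → tr X ≈ tr Y
  tr-cong (entrywise a≈ _ _ d≈) = +-cong a≈ d≈

  ≡ᴹ-mod⇒≈ᴹ : ∀ {X Y} → X ≡ᴹ Y [mod q ] → X ≈ᴹ Y
  ≡ᴹ-mod⇒≈ᴹ (a≡ , b≡ , c≡ , d≡) = entrywise (≡-mod⇒≈ a≡) (≡-mod⇒≈ b≡) (≡-mod⇒≈ c≡) (≡-mod⇒≈ d≡)

  ≈ᴹ⇒≡ᴹ-mod : ∀ {X Y} → X ≈ᴹ Y → X ≡ᴹ Y [mod q ]
  ≈ᴹ⇒≡ᴹ-mod (entrywise a≈ b≈ c≈ d≈) = ≈⇒≡-mod a≈ , ≈⇒≡-mod b≈ , ≈⇒≡-mod c≈ , ≈⇒≡-mod d≈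

  inv-inverseˡ-mod : ∀ X → det X ≈ 1ℤ → inv X · X ≈ᴹ I₂
  inv-inverseˡ-mod X det≈1 =
    ≈ᴹ-trans (≈ᴹ-reflexive (inv-inverseˡ X)) (entrywise det≈1 ≈-refl ≈-refl det≈1)

  inv-inverseʳ-mod : ∀ X → det X ≈ 1ℤ → X · inv X ≈ᴹ I₂
  inv-inverseʳ-mod X det≈1 =
    ≈ᴹ-trans (≈ᴹ-reflexive (inv-inverseʳ X)) (entrywise det≈1 ≈-refl ≈-refl det≈1)

  sandwich-cancel : ∀ {Q Q′ P P′} → Q′ · Q ≈ᴹ I₂ → P · P′ ≈ᴹ I₂ →
                    ∀ X → (Q′ · ((Q · X) · P)) · P′ ≈ᴹ X
  sandwich-cancel {Q} {Q′} {P} {P′} Q′Q≈I PP′≈I X = begin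
    (Q′ · ((Q · X) · P)) · P′   ≡⟨ cong (_· P′) (·-assoc Q′ (Q · X) P) ⟨
    ((Q′ · (Q · X)) · P) · P′   ≡⟨ ·-assoc (Q′ · (Q · X)) P P′ ⟩
    (Q′ · (Q · X)) · (P · P′)   ≡⟨ cong (_· (P · P′)) (·-assoc Q′ Q X) ⟨
    ((Q′ · Q) · X) · (P · P′)   ≈⟨ ·-cong (·-cong Q′Q≈I ≈ᴹ-refl) PP′≈I ⟩
    (I₂ · X) · I₂              ≡⟨ ·-identityʳ (I₂ · X) ⟩
    I₂ · X                     ≡⟨ ·-identityˡ X ⟩
    X                          ∎
    where open ≈-Reasoning ≈ᴹ-setoid

  det-sandwich : ∀ Q P X → det Q ≈ 1ℤ → det P ≈ 1ℤ → det X ≈ 1ℤ → det ((Q · X) · P) ≈ 1ℤ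
  det-sandwich Q P X det-Q det-P det-X =
    ≈-trans (≈-reflexive (trans (det-· (Q · X) P) (cong (_* det P) (det-· Q X))))
            (*-cong (*-cong det-Q det-X) det-P)

  Unit : ℤ → Set
  Unit w = Σ[ u ∈ ℤ ] w * u ≈ 1ℤ

  Unit-neg : ∀ {w} → Unit w → Unit (- w)
  Unit-neg {w} (u , wu≈1) = - u , ≈-trans (≈-reflexive (signs-cancel w u)) wu≈1
    where
    signs-cancel : ∀ x y → (- x) * (- y) ≡ x * y
    signs-cancel x y = solve (x ∷ y ∷ [])

  coprime⇒unit-ℕ : ∀ {m} → Coprime m q → Unit (+ m)
  coprime⇒unit-ℕ {m} m⊥q with coprime-Bézout m⊥q
  ... | Bézout.+- x y 1+yq≡xm = + x , (begin
    + m * + x        ≡⟨ ℤ.*-comm (+ m) (+ x) ⟩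
    + x * + m        ≡⟨ pos-1+* y q x m 1+yq≡xm ⟨
    1ℤ + + y * + q   ≈⟨ +-multiple≈ 1ℤ (+ y) ⟩
    1ℤ               ∎)
    where open ≈-Reasoning ≈-setoid
  ... | Bézout.-+ x y 1+xm≡yq = - (+ x) , (begin
    + m * - (+ x)             ≡⟨ expand (+ m) (+ x) ⟩
    1ℤ - (1ℤ + + x * + m)     ≡⟨ cong (λ s → 1ℤ - s) (pos-1+* x m y q 1+xm≡yq) ⟩
    1ℤ - + y * + q            ≡⟨ regroup (+ y) (+ q) ⟩
    1ℤ + - (+ y) * + q        ≈⟨ +-multiple≈ 1ℤ (- (+ y)) ⟩
    1ℤ                        ∎)
    where
    open ≈-Reasoning ≈-setoid
    expand : ∀ s t → s * - t ≡ 1ℤ - (1ℤ + t * s)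
    expand s t = solve (s ∷ t ∷ [])
    regroup : ∀ s t → 1ℤ - s * t ≡ 1ℤ + - s * t
    regroup s t = solve (s ∷ t ∷ [])

  coprime⇒unit : ∀ w → Coprime ∣ w ∣ q → Unit w
  coprime⇒unit (+ m)    = coprime⇒unit-ℕ
  coprime⇒unit -[1+ m ] = Unit-neg {+ suc m} ∘ coprime⇒unit-ℕ

  record Equivalent (M N : M2) : Set where
    field
      left right    : M2
      det-left      : det left ≈ 1ℤ
      det-right     : det right ≈ 1ℤ
      factorisation : (left · M) · right ≈ᴹ N

  Equivalent-·ʳ : ∀ {M N} J → det J ≡ 1ℤ → Equivalent M (N · J) → Equivalent M N
  Equivalent-·ʳ {M} {N} J det-J M∼NJ = record
    { left          = left
    ; right         = right · inv J
    ; det-left      = det-left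
    ; det-right     = ≈-trans (≈-reflexive (det-·-SL2ʳ right (inv J) det-J⁻¹)) det-right
    ; factorisation = begin
        (left · M) · (right · inv J)   ≡⟨ ·-assoc (left · M) right (inv J) ⟨
        ((left · M) · right) · inv J   ≈⟨ ·-cong factorisation (≈ᴹ-refl {inv J}) ⟩
        (N · J) · inv J                ≡⟨ ·-assoc N J (inv J) ⟩
        N · (J · inv J)                ≡⟨ cong (N ·_) (inv-inverseʳ-SL2 J det-J) ⟩
        N · I₂                         ≡⟨ ·-identityʳ N ⟩
        N                              ∎
    }
    where
    open Equivalent M∼NJ
    det-J⁻¹ : det (inv J) ≡ 1ℤ
    det-J⁻¹ = trans (det-inv J) det-J
    open ≈-Reasoning ≈ᴹ-setoid

  Equivalent-·ˡ : ∀ {M N} J → det J ≡ 1ℤ → Equivalent M (J · N) → Equivalent M N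
  Equivalent-·ˡ {M} {N} J det-J M∼JN = record
    { left          = inv J · left
    ; right         = right
    ; det-left      = ≈-trans (≈-reflexive (det-·-SL2ˡ (inv J) left det-J⁻¹)) det-left
    ; det-right     = det-right
    ; factorisation = begin
        ((inv J · left) · M) · right   ≡⟨ cong (_· right) (·-assoc (inv J) left M) ⟩
        (inv J · (left · M)) · right   ≡⟨ ·-assoc (inv J) (left · M) right ⟩
        inv J · ((left · M) · right)   ≈⟨ ·-cong (≈ᴹ-refl {inv J}) factorisation ⟩
        inv J · (J · N)                ≡⟨ ·-assoc (inv J) J N ⟨
        (inv J · J) · N                ≡⟨ cong (_· N) (inv-inverseˡ-SL2 J det-J) ⟩
        I₂ · N                         ≡⟨ ·-identityˡ N ⟩
        N                              ∎
    }
    where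
    open Equivalent M∼JN
    det-J⁻¹ : det (inv J) ≡ 1ℤ
    det-J⁻¹ = trans (det-inv J) det-J
    open ≈-Reasoning ≈ᴹ-setoid

  -- If αu ≡ 1 then (1 0; γu 1) · diag(1, Δ) · (α β; 0 u) = (α β; γ·αu δ·αu) ≡ (α β; γ δ).
  smith-form-unit-corner : ∀ {N Δ} → det N ≡ Δ → Unit (a N) → Equivalent (diag 1ℤ Δ) N
  smith-form-unit-corner {mat α β γ δ} refl (u , αu≈1) = record
    { left          = mat 1ℤ 0ℤ (γ * u) 1ℤ
    ; right         = mat α β 0ℤ u
    ; det-left      = ≈-reflexive det-left
    ; det-right     = ≈-trans (≈-reflexive det-right) αu≈1
    ; factorisation = entrywise (≈-reflexive top-left) (≈-reflexive top-right)
                                (cancel-αu bottom-left) (cancel-αu bottom-right)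
    }
    where
    det-left : 1ℤ * 1ℤ - 0ℤ * (γ * u) ≡ 1ℤ
    det-left = solve (γ ∷ u ∷ [])
    det-right : α * u - β * 0ℤ ≡ α * u
    det-right = solve (α ∷ β ∷ u ∷ [])
    top-left : (1ℤ * 1ℤ + 0ℤ * 0ℤ) * α + (1ℤ * 0ℤ + 0ℤ * (α * δ - β * γ)) * 0ℤ ≡ α
    top-left = solve (α ∷ β ∷ γ ∷ δ ∷ [])
    top-right : (1ℤ * 1ℤ + 0ℤ * 0ℤ) * β + (1ℤ * 0ℤ + 0ℤ * (α * δ - β * γ)) * u ≡ β
    top-right = solve (α ∷ β ∷ γ ∷ δ ∷ u ∷ [])
    bottom-left : (γ * u * 1ℤ + 1ℤ * 0ℤ) * α + (γ * u * 0ℤ + 1ℤ * (α * δ - β * γ)) * 0ℤ ≡ γ * (α * u)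
    bottom-left = solve (α ∷ β ∷ γ ∷ δ ∷ u ∷ [])
    bottom-right : (γ * u * 1ℤ + 1ℤ * 0ℤ) * β + (γ * u * 0ℤ + 1ℤ * (α * δ - β * γ)) * u ≡ δ * (α * u)
    bottom-right = solve (α ∷ β ∷ γ ∷ δ ∷ u ∷ [])
    cancel-αu : ∀ {x y} → x ≡ y * (α * u) → x ≈ y
    cancel-αu {x} {y} x≡yαu = ≈-trans (≈-reflexive x≡yαu)
                                      (≈-trans (*-cong (≈-refl {y}) αu≈1) (≈-reflexive (ℤ.*-identityʳ y)))

  smith-form : ∀ {N Δ} → det N ≡ Δ → Unit (a N) ⊎ Unit (b N) ⊎ Unit (c N) ⊎ Unit (d N) →
               Equivalent (diag 1ℤ Δ) N
  smith-form {N} det≡Δ (inj₁ unit) = smith-form-unit-corner det≡Δ unit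
  smith-form {N} det≡Δ (inj₂ (inj₁ unit)) =
    Equivalent-·ʳ S refl (smith-form-unit-corner (trans (det-·-SL2ʳ N S refl) det≡Δ)
                                                 (subst Unit (sym (a-·S N)) unit))
  smith-form {N} det≡Δ (inj₂ (inj₂ (inj₁ unit))) =
    Equivalent-·ˡ (inv S) refl (smith-form-unit-corner (trans (det-·-SL2ˡ (inv S) N refl) det≡Δ)
                                                       (subst Unit (sym (a-S⁻¹· N)) unit))
  smith-form {N} det≡Δ (inj₂ (inj₂ (inj₂ unit))) =
    Equivalent-·ˡ (inv S) refl (Equivalent-·ʳ S refl (smith-form-unit-corner
      (trans (det-·-SL2ʳ (inv S · N) S refl) (trans (det-·-SL2ˡ (inv S) N refl) det≡Δ))
      (subst Unit (sym (trans (a-·S (inv S · N)) (b-S⁻¹· N))) unit)))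

  module CosetReps (Γ : M2 → Set) (Γ-subgroup : IsSubgroupSL2 Γ)
                   (surjective : ReductionSurjective Γ q)
                   (reps : List M2) (reps-cosets : IsCosetReps Γ q reps) where

    open IsSubgroupSL2 Γ-subgroup

    private
      n : ℕ
      n = length reps

      r : Fin n → M2
      r = lookup reps

    r∈Γ : ∀ i → Γ (r i)
    r∈Γ i = All.lookup (proj₁ reps-cosets) (∈-lookup i)

    ≈ᴹ⇒SameCoset : ∀ {ρ σ} → Γ ρ → Γ σ → ρ ≈ᴹ σ → SameCoset Γ q ρ σ
    ≈ᴹ⇒SameCoset {ρ} {σ} ρ∈Γ σ∈Γ ρ≈σ =
      ρ · inv σ , (mulClos ρ (inv σ) ρ∈Γ (invClos σ σ∈Γ) , ≈ᴹ⇒≡ᴹ-mod ρσ⁻¹≈I) , sym ρσ⁻¹σ≡ρ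
      where
      det-σ : det σ ≡ 1ℤ
      det-σ = inSL2 σ σ∈Γ
      ρσ⁻¹≈I : ρ · inv σ ≈ᴹ I₂
      ρσ⁻¹≈I = ≈ᴹ-trans (·-cong ρ≈σ (≈ᴹ-refl {inv σ})) (inv-inverseʳ-mod σ (≈-reflexive det-σ))
      ρσ⁻¹σ≡ρ : (ρ · inv σ) · σ ≡ ρ
      ρσ⁻¹σ≡ρ = begin
        (ρ · inv σ) · σ               ≡⟨ ·-assoc ρ (inv σ) σ ⟩
        ρ · (inv σ · σ)               ≡⟨ cong (ρ ·_) (inv-inverseˡ σ) ⟩
        ρ · diag (det σ) (det σ)      ≡⟨ cong (λ s → ρ · diag s s) det-σ ⟩
        ρ · I₂                        ≡⟨ ·-identityʳ ρ ⟩
        ρ                             ∎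
        where open ≡-Reasoning

    reps-unique : ∀ {i j} → r i ≈ᴹ r j → i ≡ j
    reps-unique {i} {j} rᵢ≈rⱼ with Fin.<-cmp i j
    ... | tri< i<j _ _ = contradiction (≈ᴹ⇒SameCoset (r∈Γ i) (r∈Γ j) rᵢ≈rⱼ)
                                       (AllPairs-lookup (proj₂ (proj₂ reps-cosets)) i<j)
    ... | tri≈ _ i≡j _ = i≡j
    ... | tri> _ _ j<i = contradiction (≈ᴹ⇒SameCoset (r∈Γ j) (r∈Γ i) (≈ᴹ-sym rᵢ≈rⱼ))
                                       (AllPairs-lookup (proj₂ (proj₂ reps-cosets)) j<i)

    reps-cover : ∀ M → det M ≈ 1ℤ → Σ[ i ∈ Fin n ] r i ≈ᴹ M
    reps-cover M det≈1 with surjective M (≈⇒≡-mod det≈1)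
    ... | γ , γ∈Γ , γ≡M = Any.index coset , represents (lookup-index coset)
      where
      coset : Any (SameCoset Γ q γ) reps
      coset = proj₁ (proj₂ reps-cosets) γ γ∈Γ
      represents : ∀ {ρ} → SameCoset Γ q γ ρ → ρ ≈ᴹ M
      represents {ρ} (δ , (_ , δ≡I) , γ≡δρ) = begin
        ρ        ≡⟨ ·-identityˡ ρ ⟨
        I₂ · ρ   ≈⟨ ·-cong (≈ᴹ-sym (≡ᴹ-mod⇒≈ᴹ {δ} {I₂} δ≡I)) (≈ᴹ-refl {ρ}) ⟩
        δ · ρ    ≡⟨ γ≡δρ ⟨
        γ        ≈⟨ ≡ᴹ-mod⇒≈ᴹ {γ} {M} γ≡M ⟩
        M        ∎
        where open ≈-Reasoning ≈ᴹ-setoid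

    translate : ∀ Q P → det Q ≈ 1ℤ → det P ≈ 1ℤ → ∀ i → Σ[ j ∈ Fin n ] r j ≈ᴹ (Q · r i) · P
    translate Q P det-Q det-P i =
      reps-cover ((Q · r i) · P)
                 (det-sandwich Q P (r i) det-Q det-P (≈-reflexive (inSL2 (r i) (r∈Γ i))))

    translation-permutation : ∀ Q P → det Q ≈ 1ℤ → det P ≈ 1ℤ →
                              Σ[ π ∈ Permutation′ n ] (∀ i → r (π ⟨$⟩ʳ i) ≈ᴹ (Q · r i) · P)
    translation-permutation Q P det-Q det-P =
      permutation σ τ στ≗id τσ≗id , proj₂ ∘ forward
      where
      forward : ∀ i → Σ[ j ∈ Fin n ] r j ≈ᴹ (Q · r i) · P
      forward = translate Q P det-Q det-P
      backward : ∀ i → Σ[ j ∈ Fin n ] r j ≈ᴹ (inv Q · r i) · inv P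
      backward = translate (inv Q) (inv P) (≈-trans (≈-reflexive (det-inv Q)) det-Q)
                                           (≈-trans (≈-reflexive (det-inv P)) det-P)
      σ τ : Fin n → Fin n
      σ = proj₁ ∘ forward
      τ = proj₁ ∘ backward
      τσ≗id : ∀ i → τ (σ i) ≡ i
      τσ≗id i = reps-unique (begin
        r (τ (σ i))                        ≈⟨ proj₂ (backward (σ i)) ⟩
        (inv Q · r (σ i)) · inv P
          ≈⟨ ·-cong (·-cong (≈ᴹ-refl {inv Q}) (proj₂ (forward i))) (≈ᴹ-refl {inv P}) ⟩
        (inv Q · ((Q · r i) · P)) · inv P
          ≈⟨ sandwich-cancel {Q} {inv Q} {P} {inv P}
                             (inv-inverseˡ-mod Q det-Q) (inv-inverseʳ-mod P det-P) (r i) ⟩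
        r i                                ∎)
        where open ≈-Reasoning ≈ᴹ-setoid
      στ≗id : ∀ i → σ (τ i) ≡ i
      στ≗id i = reps-unique (begin
        r (σ (τ i))                        ≈⟨ proj₂ (forward (τ i)) ⟩
        (Q · r (τ i)) · P
          ≈⟨ ·-cong (·-cong (≈ᴹ-refl {Q}) (proj₂ (backward i))) (≈ᴹ-refl {P}) ⟩
        (Q · ((inv Q · r i) · inv P)) · P
          ≈⟨ sandwich-cancel {inv Q} {Q} {inv P} {P}
                             (inv-inverseʳ-mod Q det-Q) (inv-inverseˡ-mod P det-P) (r i) ⟩
        r i                                ∎)
        where open ≈-Reasoning ≈ᴹ-setoid

    sum-translate : ∀ Q P → det Q ≈ 1ℤ → det P ≈ 1ℤ →
                    (f : M2 → ℤ) → (∀ {X Y} → X ≈ᴹ Y → f X ≡ f Y) →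
                    sumℤ (map (λ γ → f ((Q · γ) · P)) reps) ≡ sumℤ (map f reps)
    sum-translate Q P det-Q det-P f f-cong = begin
      sumℤ (map (λ γ → f ((Q · γ) · P)) reps)  ≡⟨ sumℤ-map-lookup _ reps ⟩
      sum (λ i → f ((Q · r i) · P))            ≡⟨ sum-cong-≗ (λ i → f-cong (proj₂ π i)) ⟨
      sum (λ i → f (r (proj₁ π ⟨$⟩ʳ i)))        ≡⟨ ∑-permute (f ∘ r) (proj₁ π) ⟨
      sum (f ∘ r)                              ≡⟨ sumℤ-map-lookup f reps ⟨
      sumℤ (map f reps)                        ∎
      where
      open ≡-Reasoning
      π : Σ[ π ∈ Permutation′ n ] (∀ i → r (π ⟨$⟩ʳ i) ≈ᴹ (Q · r i) · P)
      π = translation-permutation Q P det-Q det-P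

    sum-Equivalent-trace : ∀ {M N} → Equivalent M N →
                           (f : ℤ → ℤ) → (∀ {x y} → x ≈ y → f x ≡ f y) →
                           sumℤ (map (λ γ → f (tr (N · γ))) reps)
                           ≡ sumℤ (map (λ γ → f (tr (M · γ))) reps)
    sum-Equivalent-trace {M} {N} M∼N f f-cong = begin
      sumℤ (map (λ γ → f (tr (N · γ))) reps)
        ≡⟨ sumℤ-map-cong (λ γ → f-cong (tr-cong (·-cong (≈ᴹ-sym factorisation) (≈ᴹ-refl {γ}))))
                         reps ⟩
      sumℤ (map (λ γ → f (tr (((left · M) · right) · γ))) reps)
        ≡⟨ sumℤ-map-cong (λ γ → cong f (tr-sandwich left M right γ)) reps ⟩
      sumℤ (map (λ γ → f (tr (M · ((right · γ) · left)))) reps)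
        ≡⟨ sum-translate right left det-right det-left (f ∘ tr ∘ (M ·_))
                         (f-cong ∘ tr-cong ∘ ·-cong (≈ᴹ-refl {M})) ⟩
      sumℤ (map (λ γ → f (tr (M · γ))) reps)
        ∎
      where
      open Equivalent M∼N
      open ≡-Reasoning

module _ {p : ℕ} (p-prime : Prime p) (ℓ : ℕ) where
  open Modulo (p ^ ℓ) using (Unit; coprime⇒unit)

  p∤⇒unit : ∀ w → ¬ p ℕ∣ ∣ w ∣ → Unit w
  p∤⇒unit w p∤w = coprime⇒unit w (coprime-^ʳ (prime∤⇒coprime p-prime p∤w) ℓ)

  gcd4≡1⇒unit-entry : ∀ A B C D → gcd4 A B C D ≡ 1 → Unit A ⊎ Unit C ⊎ Unit B ⊎ Unit D
  gcd4≡1⇒unit-entry A B C D content≡1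
    with p ℕ∣? ∣ A ∣ | p ℕ∣? ∣ B ∣ | p ℕ∣? ∣ C ∣ | p ℕ∣? ∣ D ∣
  ... | no p∤A  | _       | _       | _       = inj₁ (p∤⇒unit A p∤A)
  ... | yes _   | _       | no p∤C  | _       = inj₂ (inj₁ (p∤⇒unit C p∤C))
  ... | yes _   | no p∤B  | yes _   | _       = inj₂ (inj₂ (inj₁ (p∤⇒unit B p∤B)))
  ... | yes _   | yes _   | yes _   | no p∤D  = inj₂ (inj₂ (inj₂ (p∤⇒unit D p∤D)))
  ... | yes p∣A | yes p∣B | yes p∣C | yes p∣D =
    contradiction (subst Prime (∣1⇒≡1 (subst (p ℕ∣_) content≡1 p∣content)) p-prime) ¬prime[1]
    where
    p∣content : p ℕ∣ gcd4 A B C D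
    p∣content = gcd-greatest (gcd-greatest p∣A p∣B) (gcd-greatest p∣C p∣D)

-- Only the surjectivity of Γ → SL₂(ℤ/p^ℓ) is used; Zariski density and oddness of p are not.
lemma3p6 : (Γ : M2 → Set) → IsSubgroupSL2 Γ → ZariskiDense Γ →
    (A B C D : ℤ) → gcd4 A B C D ≡ 1 →
    (p ℓ : ℕ) → Good Γ p → 1 ≤ ℓ →
    (reps : List M2) → IsCosetReps Γ (p ^ ℓ) reps →
    (n : ℤ) →
    sumℤ (map (λ γ → ramanujan (p ^ ℓ) (𝓛 A B C D γ - n)) reps)
    ≡ sumℤ (map (λ γ → ramanujan (p ^ ℓ) (a γ + (A * D - B * C) * d γ - n)) reps)
lemma3p6 Γ Γ-subgroup _ A B C D content≡1 p ℓ (p-prime , _ , surjective) ℓ≥1 reps reps-cosets n =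
  begin
    sumℤ (map (λ γ → f (𝓛 A B C D γ)) reps)
      ≡⟨ sumℤ-map-cong (λ γ → cong f (𝓛-as-trace A B C D γ)) reps ⟩
    sumℤ (map (λ γ → f (tr (N · γ))) reps)
      ≡⟨ sum-Equivalent-trace N∼diag f f-cong ⟩
    sumℤ (map (λ γ → f (tr (diag 1ℤ Δ · γ))) reps)
      ≡⟨ sumℤ-map-cong (λ γ → cong f (diagonal-form-as-trace Δ γ)) reps ⟨
    sumℤ (map (λ γ → f (a γ + Δ * d γ)) reps)
  ∎
  where
  open ≡-Reasoning
  q : ℕ
  q = p ^ ℓ
  open Modulo q
  open CosetReps Γ Γ-subgroup (surjective ℓ ℓ≥1) reps reps-cosets
  N : M2
  N = mat A C B D
  Δ : ℤ
  Δ = A * D - B * C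
  f : ℤ → ℤ
  f x = ramanujan q (x - n)
  f-cong : ∀ {x y} → x ≈ y → f x ≡ f y
  f-cong x≈y = ramanujan-cong (+-cong x≈y ≈-refl)
  N∼diag : Equivalent (diag 1ℤ Δ) N
  N∼diag = smith-form (cong (λ t → A * D - t) (ℤ.*-comm C B))
                      (gcd4≡1⇒unit-entry p-prime ℓ A B C D content≡1)
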